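{- Let $A$ be an alphabet with an involution without fixed points ($a\neq\overline a$ for all $a\in A$). Let $n\in\mathbb Z$ and let $q\in\mathrm{FG}(A)$ be a primitive and cyclically reduced word. Then $\delta_q(q^n)=n$, where $q^n$ denotes the reduced word representing the $n$-th power of $q$ in $\mathrm{FG}(A)$.
   Context: $\mathrm{FG}(A)=A^*/\{a\overline a=1\}$ is identified with the set of reduced words (no factor $a\overline a$). A word $q$ is cyclically reduced if $qq$ is reduced, and primitive if it is nonempty and not of the form $v^i$ with $i>1$. For a word $u$, $|u|_q$ is the number of occurrences of $q$ as a factor of $u$, and $\delta_q(u)=|u|_q-|u|_{\overline q}$, where $\overline{a_1\cdots a_m}=\overline{a_m}\cdots\overline{a_1}$. -}

module Defs where

open import Data.Bool using (Bool; true; false; if_then_else_; T?)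
open import Data.Nat using (ℕ; zero; suc; _>_)
open import Data.Integer using (ℤ; +_; -[1+_]; _-_)
open import Data.List using (List; []; _∷_; _++_; reverse; map; concat; replicate; length; filter; tails)
open import Data.Product using (Σ; _×_; _,_)
open import Relation.Nullary using (¬_; Dec; yes; no)
open import Relation.Nullary.Decidable using (⌊_⌋)
open import Relation.Binary.PropositionalEquality using (_≡_; _≢_)
open import Relation.Binary.Definitions using (DecidableEquality)

record InvAlphabet : Set₁ where
  field
    Letter : Set
    _≟_    : DecidableEquality Letter
    inv    : Letter → Letter
    inv-inv : ∀ a → inv (inv a) ≡ a
    inv-nofix : ∀ a → inv a ≢ a

module Words (𝔸 : InvAlphabet) where
  open InvAlphabet 𝔸

  Word : Set
  Word = List Letter

  invW : Word → Word
  invW u = reverse (map inv u)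

  Reduced : Word → Set
  Reduced u = ∀ (x y : Word) (a : Letter) → u ≢ x ++ (a ∷ inv a ∷ y)

  CyclicallyReduced : Word → Set
  CyclicallyReduced q = Reduced (q ++ q)

  _^w_ : Word → ℕ → Word
  v ^w i = concat (replicate i v)

  Primitive : Word → Set
  Primitive q = (q ≢ []) × (¬ Σ Word (λ v → Σ ℕ (λ i → (i > 1) × (q ≡ v ^w i))))

  -- free reduction (normal form in FG(A)) by a stack
  push : Letter → Word → Word
  push a [] = a ∷ []
  push a (b ∷ s) = if ⌊ b ≟ inv a ⌋ then s else a ∷ b ∷ s

  reduce : Word → Word
  reduce [] = []
  reduce (a ∷ u) = push a (reduce u)

  powFG : Word → ℤ → Word
  powFG q (+ n)     = reduce (q ^w n)
  powFG q -[1+ n ]  = reduce (invW q ^w suc n)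

  isPrefix : Word → Word → Bool
  isPrefix [] _ = true
  isPrefix (_ ∷ _) [] = false
  isPrefix (a ∷ p) (b ∷ s) = if ⌊ a ≟ b ⌋ then isPrefix p s else false

  occ : Word → Word → ℕ
  occ u q = length (filter (λ s → T? (isPrefix q s)) (tails u))

  δ : Word → Word → ℤ
  δ q u = (+ occ u q) - (+ occ u (invW q))

-- Since q is cyclically reduced, every power q^m is already freely reduced, so powFG q n is
-- the literal concatenation q^n (or q̄^|n| for negative n), and it suffices to count factors
-- of a literal power p^m. An occurrence of p in p^m that does not start at a multiple of |p|
-- would exhibit p = r t = t r with r, t nonempty, which makes p a proper power. An occurrence
-- of p̄ starting inside a copy p = r t gives p̄ = t r, hence t̄ = t; but a nonempty reduced
-- word is never its own formal inverse, because its middle would be a letter a = ā or a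
-- factor a ā. So |p^m|_p = m and |p^m|_p̄ = 0, for p = q and for p = q̄.
module Submission where

open import Defs
open import Data.Bool using (true; false)
open import Data.Empty using (⊥-elim)
open import Data.Integer using (ℤ; +_; -[1+_]; _-_)
open import Data.Integer.Properties using (+-identityʳ)
open import Data.List using (List; []; _∷_; _++_; _∷ʳ_; reverse; map; concat; replicate; length)
open import Data.List.Properties
  using (++-assoc; ++-identityʳ; ∷-injective; ∷-injectiveˡ; ∷-injectiveʳ; ∷ʳ-injective; ∷ʳ-++;
         length-++; length-++-≤ˡ; length-++-comm; length-map; length-reverse; map-++; map-∘;
         map-cong; map-id; reverse-++; reverse-map; reverse-involutive)
open import Data.List.Relation.Unary.Linked using (Linked; []; [-]; _∷_)
open import Data.List.Reverse using (reverseView; []; _∶_∶ʳ_)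
open import Data.Nat using (zero; suc; _+_; _≤_; _<_; z≤n; s≤s)
open import Data.Nat.Induction using (<-wellFounded)
open import Data.Nat.Properties using (≤-total; ≤-trans; m≤n+m; m<m+n; m<n+m; suc-injective)
open import Data.Product using (∃-syntax; _×_; _,_; proj₁; proj₂)
open import Data.Sum using (inj₁; inj₂)
open import Induction.WellFounded using (Acc; acc)
open import Level using (Level)
open import Relation.Binary.Core using (Rel)
open import Relation.Binary.PropositionalEquality
open import Relation.Nullary using (¬_; yes; no)

module _ {a : Level} {A : Set a} where

  ++-equidivisible : ∀ (xs ys us vs : List A) → xs ++ ys ≡ us ++ vs → length us ≤ length xs →
                     ∃[ k ] xs ≡ us ++ k × vs ≡ k ++ ys
  ++-equidivisible xs ys [] vs e _ = xs , refl , sym e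
  ++-equidivisible (x ∷ xs) ys (u ∷ us) vs e (s≤s us≤xs) with refl , e′ ← ∷-injective e =
    let k , xs≡usk , vs≡kys = ++-equidivisible xs ys us vs e′ us≤xs
    in  k , cong (x ∷_) xs≡usk , vs≡kys

  ++-injectiveˡ : ∀ (xs ys us vs : List A) → xs ++ ys ≡ us ++ vs → length xs ≡ length us → xs ≡ us
  ++-injectiveˡ []       ys []       vs e l = refl
  ++-injectiveˡ (x ∷ xs) ys (u ∷ us) vs e l with refl , e′ ← ∷-injective e =
    cong (x ∷_) (++-injectiveˡ xs ys us vs e′ (suc-injective l))

  concat-replicate-+ : ∀ (z : List A) i j →
    concat (replicate (i + j) z) ≡ concat (replicate i z) ++ concat (replicate j z)
  concat-replicate-+ z zero    j = refl
  concat-replicate-+ z (suc i) j =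
    trans (cong (z ++_) (concat-replicate-+ z i j)) (sym (++-assoc z _ _))

  concat-replicate-∷ʳ : ∀ (z : List A) i → concat (replicate i z) ++ z ≡ z ++ concat (replicate i z)
  concat-replicate-∷ʳ z zero    = sym (++-identityʳ z)
  concat-replicate-∷ʳ z (suc i) = trans (++-assoc z _ z) (cong (z ++_) (concat-replicate-∷ʳ z i))

  CommonRoot : List A → List A → Set a
  CommonRoot x y = ∃[ z ] ∃[ i ] ∃[ j ] x ≡ concat (replicate i z) × y ≡ concat (replicate j z)

  -- Euclid's algorithm on lengths: from x y = y x and |x| ≤ |y| we get y = x k with x k = k x.
  ++-comm⇒CommonRoot : ∀ x y → x ++ y ≡ y ++ x → CommonRoot x y
  ++-comm⇒CommonRoot x y = go x y (<-wellFounded _)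
    where
    extend : ∀ x y k → y ≡ x ++ k → CommonRoot x k → CommonRoot x y
    extend x y k y≡xk (z , i , j , x≡zⁱ , k≡zʲ) =
      z , i , i + j , x≡zⁱ ,
      trans y≡xk (trans (cong₂ _++_ x≡zⁱ k≡zʲ) (sym (concat-replicate-+ z i j)))

    go : ∀ x y → Acc _<_ (length x + length y) → x ++ y ≡ y ++ x → CommonRoot x y
    go []         y         _         _ = y , 0 , 1 , refl , sym (++-identityʳ y)
    go x@(_ ∷ _) []         _         _ = x , 1 , 0 , sym (++-identityʳ x) , refl
    go x@(_ ∷ _) y@(_ ∷ _) (acc rec) e with ≤-total (length x) (length y)
    ... | inj₁ x≤y =
      let k , y≡xk , y≡kx = ++-equidivisible y x x y (sym e) x≤y
          |y|≡|x|+|k| = trans (cong length y≡xk) (length-++ x)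
      in  extend x y k y≡xk
            (go x k (rec (subst (_< length x + length y) |y|≡|x|+|k| (m<n+m (length y) (s≤s z≤n))))
                (trans (sym y≡xk) y≡kx))
    ... | inj₂ y≤x =
      let k , x≡yk , x≡ky = ++-equidivisible x y y x e y≤x
          |x|≡|y|+|k| = trans (cong length x≡yk) (length-++ y)
          z , i , j , y≡zⁱ , x≡zʲ = extend y x k x≡yk
            (go y k (rec (subst (_< length x + length y) |x|≡|y|+|k| (m<m+n (length x) (s≤s z≤n))))
                (trans (sym x≡yk) x≡ky))
      in  z , j , i , x≡zʲ , y≡zⁱ

module _ {a ℓ : Level} {A : Set a} {R : Rel A ℓ} where

  Linked-++⁻ˡ : ∀ xs {ys} → Linked R (xs ++ ys) → Linked R xs
  Linked-++⁻ˡ []           _        = []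
  Linked-++⁻ˡ (x ∷ [])     _        = [-]
  Linked-++⁻ˡ (x ∷ y ∷ xs) (r ∷ rs) = r ∷ Linked-++⁻ˡ (y ∷ xs) rs

  Linked-join : ∀ xs {y ys} → Linked R (xs ∷ʳ y) → Linked R (y ∷ ys) → Linked R (xs ++ y ∷ ys)
  Linked-join []           _        rs  = rs
  Linked-join (x ∷ [])     (r ∷ _)  rs  = r ∷ rs
  Linked-join (x ∷ y ∷ xs) (r ∷ rs) rs′ = r ∷ Linked-join (y ∷ xs) rs rs′

  Linked-concat-replicate : ∀ q → Linked R (q ++ q) → ∀ k → Linked R (concat (replicate (suc k) q))
  Linked-concat-replicate []      _  zero    = []
  Linked-concat-replicate []      rs (suc k) = Linked-concat-replicate [] rs k
  Linked-concat-replicate (x ∷ q) rs zero    =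
    subst (Linked R) (sym (++-identityʳ (x ∷ q))) (Linked-++⁻ˡ (x ∷ q) rs)
  Linked-concat-replicate (x ∷ q) rs (suc k) =
    Linked-join (x ∷ q)
      (Linked-++⁻ˡ ((x ∷ q) ∷ʳ x) (subst (Linked R) (sym (∷ʳ-++ (x ∷ q) x q)) rs))
      (Linked-concat-replicate (x ∷ q) rs k)

module FreeGroupWords (𝔸 : InvAlphabet) where
  open InvAlphabet 𝔸
  open Words 𝔸

  _⊑_ : Word → Word → Set
  q ⊑ s = ∃[ w ] s ≡ q ++ w

  isPrefix-sound : ∀ q s → isPrefix q s ≡ true → q ⊑ s
  isPrefix-sound []      s       _ = s , refl
  isPrefix-sound (a ∷ q) (b ∷ s) h with a ≟ b
  ... | yes refl = let w , s≡qw = isPrefix-sound q s h in w , cong (a ∷_) s≡qw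

  isPrefix-++ : ∀ q w → isPrefix q (q ++ w) ≡ true
  isPrefix-++ []      w = refl
  isPrefix-++ (a ∷ q) w with a ≟ a
  ... | yes _  = isPrefix-++ q w
  ... | no a≢a = ⊥-elim (a≢a refl)

  occ-[] : ∀ q → q ≢ [] → occ [] q ≡ 0
  occ-[] []      q≢[] = ⊥-elim (q≢[] refl)
  occ-[] (_ ∷ _) _    = refl

  occ-self-++ : ∀ a q w → occ (a ∷ q ++ w) (a ∷ q) ≡ suc (occ (q ++ w) (a ∷ q))
  occ-self-++ a q w rewrite isPrefix-++ (a ∷ q) w = refl

  occ-∷-⋢ : ∀ a u q → ¬ q ⊑ (a ∷ u) → occ (a ∷ u) q ≡ occ u q
  occ-∷-⋢ a u q q⋢au with isPrefix q (a ∷ u) in eq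
  ... | true  = ⊥-elim (q⋢au (isPrefix-sound q (a ∷ u) eq))
  ... | false = refl

  occ-++-skip : ∀ t s q → (∀ t₁ t₂ → t ≡ t₁ ++ t₂ → t₂ ≢ [] → ¬ q ⊑ (t₂ ++ s)) →
                occ (t ++ s) q ≡ occ s q
  occ-++-skip []      s q _        = refl
  occ-++-skip (a ∷ t) s q no-start =
    trans (occ-∷-⋢ a (t ++ s) q (no-start [] (a ∷ t) refl λ ()))
          (occ-++-skip t s q λ t₁ t₂ t≡t₁t₂ → no-start (a ∷ t₁) t₂ (cong (a ∷_) t≡t₁t₂))

  Reduced-++⁻ˡ : ∀ x y → Reduced (x ++ y) → Reduced x
  Reduced-++⁻ˡ x y red u v a x≡uaāv =
    red u (v ++ y) a (trans (cong (_++ y) x≡uaāv) (++-assoc u (a ∷ inv a ∷ v) y))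

  Reduced-++⁻ʳ : ∀ x y → Reduced (x ++ y) → Reduced y
  Reduced-++⁻ʳ x y red u v a y≡uaāv =
    red (x ++ u) v a (trans (cong (x ++_) y≡uaāv) (sym (++-assoc x u (a ∷ inv a ∷ v))))

  NonInverse : Letter → Letter → Set
  NonInverse a b = b ≢ inv a

  Reduced⇒Linked : ∀ u → Reduced u → Linked NonInverse u
  Reduced⇒Linked []          _   = []
  Reduced⇒Linked (a ∷ [])    _   = [-]
  Reduced⇒Linked (a ∷ b ∷ s) red =
    (λ b≡ā → red [] s a (cong (λ c → a ∷ c ∷ s) b≡ā))
    ∷ Reduced⇒Linked (b ∷ s) (Reduced-++⁻ʳ (a ∷ []) (b ∷ s) red)

  reduce-Linked : ∀ {u} → Linked NonInverse u → reduce u ≡ u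
  reduce-Linked []  = refl
  reduce-Linked [-] = refl
  reduce-Linked {a ∷ b ∷ s} (b≢ā ∷ rs) rewrite reduce-Linked rs with b ≟ inv a
  ... | yes b≡ā = ⊥-elim (b≢ā b≡ā)
  ... | no _    = refl

  reduce-power : ∀ {q} → CyclicallyReduced q → ∀ n → reduce (q ^w n) ≡ q ^w n
  reduce-power         _  zero    = refl
  reduce-power {q} cr (suc k) =
    reduce-Linked (Linked-concat-replicate q (Reduced⇒Linked (q ++ q) cr) k)

  invW-++ : ∀ x y → invW (x ++ y) ≡ invW y ++ invW x
  invW-++ x y = trans (cong reverse (map-++ inv x y)) (reverse-++ (map inv x) (map inv y))

  invW-involutive : ∀ u → invW (invW u) ≡ u
  invW-involutive u = begin
    reverse (map inv (reverse (map inv u))) ≡⟨ cong reverse (reverse-map inv (map inv u)) ⟩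
    reverse (reverse (map inv (map inv u))) ≡⟨ reverse-involutive _ ⟩
    map inv (map inv u)                     ≡⟨ map-∘ u ⟨
    map (λ x → inv (inv x)) u               ≡⟨ map-cong inv-inv u ⟩
    map (λ x → x) u                         ≡⟨ map-id u ⟩
    u                                       ∎
    where open ≡-Reasoning

  length-invW : ∀ u → length (invW u) ≡ length u
  length-invW u = trans (length-reverse (map inv u)) (length-map inv u)

  invW-≢[] : ∀ {u} → u ≢ [] → invW u ≢ []
  invW-≢[] {u} u≢[] ū≡[] = u≢[] (trans (sym (invW-involutive u)) (cong invW ū≡[]))

  invW-power : ∀ v i → invW (v ^w i) ≡ invW v ^w i
  invW-power v zero    = refl
  invW-power v (suc i) = begin
    invW (v ++ v ^w i)       ≡⟨ invW-++ v (v ^w i) ⟩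
    invW (v ^w i) ++ invW v  ≡⟨ cong (_++ invW v) (invW-power v i) ⟩
    invW v ^w i ++ invW v    ≡⟨ concat-replicate-∷ʳ (invW v) i ⟩
    invW v ^w suc i          ∎
    where open ≡-Reasoning

  Reduced-invW : ∀ u → Reduced u → Reduced (invW u)
  Reduced-invW u red x y a ū≡xaāy = red (invW y) (invW x) a (begin
    u                                          ≡⟨ invW-involutive u ⟨
    invW (invW u)                              ≡⟨ cong invW ū≡xaāy ⟩
    invW (x ++ (a ∷ inv a ∷ []) ++ y)          ≡⟨ invW-++ x _ ⟩
    invW ((a ∷ inv a ∷ []) ++ y) ++ invW x     ≡⟨ cong (_++ invW x) (invW-++ (a ∷ inv a ∷ []) y) ⟩
    (invW y ++ inv (inv a) ∷ inv a ∷ []) ++ invW x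
      ≡⟨ cong (λ c → (invW y ++ c ∷ inv a ∷ []) ++ invW x) (inv-inv a) ⟩
    (invW y ++ a ∷ inv a ∷ []) ++ invW x       ≡⟨ ++-assoc (invW y) _ (invW x) ⟩
    invW y ++ a ∷ inv a ∷ invW x               ∎)
    where open ≡-Reasoning

  CyclicallyReduced-invW : ∀ q → CyclicallyReduced q → CyclicallyReduced (invW q)
  CyclicallyReduced-invW q cr = subst Reduced (invW-++ q q) (Reduced-invW (q ++ q) cr)

  Primitive-invW : ∀ q → Primitive q → Primitive (invW q)
  Primitive-invW q (q≢[] , not-power) =
    invW-≢[] q≢[] ,
    λ (v , i , i>1 , q̄≡vⁱ) → not-power (invW v , i , i>1 ,
      trans (sym (invW-involutive q)) (trans (cong invW q̄≡vⁱ) (invW-power v i)))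

  -- The two ends of a self-inverse word are mutually inverse letters; peel them off.
  Reduced-self-inverse⇒[] : ∀ w → Reduced w → invW w ≡ w → w ≡ []
  Reduced-self-inverse⇒[] w = go w (<-wellFounded _)
    where
    go : ∀ w → Acc _<_ (length w) → Reduced w → invW w ≡ w → w ≡ []
    go []      _         _   _    = refl
    go (a ∷ w) (acc rec) red w̄≡w with reverseView w
    ... | [] = ⊥-elim (inv-nofix a (∷-injectiveˡ w̄≡w))
    ... | m ∶ _ ∶ʳ b = ⊥-elim (red [] [] a (cong (a ∷_) (cong₂ _∷ʳ_ m≡[] (sym ā≡b))))
      where
      ends : inv b ∷ (invW m ∷ʳ inv a) ≡ a ∷ (m ∷ʳ b)
      ends = trans (sym (trans (invW-++ (a ∷ m) (b ∷ [])) (cong (inv b ∷_) (invW-++ (a ∷ []) m)))) w̄≡w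
      m̄≡m : invW m ≡ m
      m̄≡m = proj₁ (∷ʳ-injective (invW m) m (∷-injectiveʳ ends))
      ā≡b : inv a ≡ b
      ā≡b = proj₂ (∷ʳ-injective (invW m) m (∷-injectiveʳ ends))
      m≡[] : m ≡ []
      m≡[] = go m (rec (s≤s (length-++-≤ˡ m)))
               (Reduced-++⁻ˡ m (b ∷ []) (Reduced-++⁻ʳ (a ∷ []) (m ∷ʳ b) red)) m̄≡m

  -- Appending a further copy of p turns t p^m into (t r) (t p^m).
  power-window : ∀ {p r t u w} m → p ≡ r ++ t → u ++ w ≡ t ++ p ^w m → length u ≡ length p →
                 u ≡ t ++ r
  power-window {p} {r} {t} {u} {w} m p≡rt uw≡tpᵐ |u|≡|p| =
    ++-injectiveˡ u (w ++ p) (t ++ r) (t ++ p ^w m) extended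
      (trans |u|≡|p| (trans (cong length p≡rt) (length-++-comm r t)))
    where
    open ≡-Reasoning
    extended : u ++ w ++ p ≡ (t ++ r) ++ t ++ p ^w m
    extended = begin
      u ++ w ++ p             ≡⟨ ++-assoc u w p ⟨
      (u ++ w) ++ p           ≡⟨ cong (_++ p) uw≡tpᵐ ⟩
      (t ++ p ^w m) ++ p      ≡⟨ ++-assoc t (p ^w m) p ⟩
      t ++ p ^w m ++ p        ≡⟨ cong (t ++_) (concat-replicate-∷ʳ p m) ⟩
      t ++ p ++ p ^w m        ≡⟨ cong (λ x → t ++ x ++ p ^w m) p≡rt ⟩
      t ++ (r ++ t) ++ p ^w m ≡⟨ cong (t ++_) (++-assoc r t (p ^w m)) ⟩
      t ++ r ++ t ++ p ^w m   ≡⟨ ++-assoc t r (t ++ p ^w m) ⟨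
      (t ++ r) ++ t ++ p ^w m ∎

  Primitive⇒¬++-comm : ∀ {p r t} → Primitive p → p ≡ r ++ t → r ≢ [] → t ≢ [] → r ++ t ≢ t ++ r
  Primitive⇒¬++-comm {r = r} {t} (_ , not-power) p≡rt r≢[] t≢[] rt≡tr
    with ++-comm⇒CommonRoot r t rt≡tr
  ... | _ , zero  , _     , r≡[] , _    = r≢[] r≡[]
  ... | _ , suc _ , zero  , _    , t≡[] = t≢[] t≡[]
  ... | z , suc i , suc j , r≡zⁱ , t≡zʲ =
    not-power (z , suc i + suc j , s≤s (≤-trans (s≤s z≤n) (m≤n+m (suc j) i)) ,
      trans p≡rt (trans (cong₂ _++_ r≡zⁱ t≡zʲ) (sym (concat-replicate-+ z (suc i) (suc j)))))

  Primitive⇒⋢shifted-power : ∀ {p r t} m → Primitive p → p ≡ r ++ t → r ≢ [] → t ≢ [] →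
                             ¬ p ⊑ (t ++ p ^w m)
  Primitive⇒⋢shifted-power m prim p≡rt r≢[] t≢[] (w , tpᵐ≡pw) =
    Primitive⇒¬++-comm prim p≡rt r≢[] t≢[]
      (trans (sym p≡rt) (power-window m p≡rt (sym tpᵐ≡pw) refl))

  CyclicallyReduced⇒invW⋢shifted-power : ∀ {p r t} m → CyclicallyReduced p → p ≡ r ++ t → t ≢ [] →
                                         ¬ invW p ⊑ (t ++ p ^w m)
  CyclicallyReduced⇒invW⋢shifted-power {p} {r} {t} m cr p≡rt t≢[] (w , tpᵐ≡p̄w) =
    t≢[] (Reduced-self-inverse⇒[] t reduced-t t̄≡t)
    where
    p̄≡tr : invW p ≡ t ++ r
    p̄≡tr = power-window m p≡rt (sym tpᵐ≡p̄w) (length-invW p)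
    t̄≡t : invW t ≡ t
    t̄≡t = ++-injectiveˡ (invW t) (invW r) t r
            (trans (sym (invW-++ r t)) (trans (cong invW (sym p≡rt)) p̄≡tr)) (length-invW t)
    reduced-t : Reduced t
    reduced-t = Reduced-++⁻ʳ r t (subst Reduced p≡rt (Reduced-++⁻ˡ p p cr))

  occ-power-self : ∀ {p} → Primitive p → ∀ m → occ (p ^w m) p ≡ m
  occ-power-self {[]}     (p≢[] , _) _ = ⊥-elim (p≢[] refl)
  occ-power-self {a ∷ p′} prim zero    = refl
  occ-power-self {a ∷ p′} prim (suc m) = begin
    occ (a ∷ p′ ++ p ^w m) p   ≡⟨ occ-self-++ a p′ (p ^w m) ⟩
    suc (occ (p′ ++ p ^w m) p) ≡⟨ cong suc (occ-++-skip p′ (p ^w m) p no-inner-start) ⟩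
    suc (occ (p ^w m) p)       ≡⟨ cong suc (occ-power-self prim m) ⟩
    suc m                      ∎
    where
    open ≡-Reasoning
    p : Word
    p = a ∷ p′
    no-inner-start : ∀ t₁ t₂ → p′ ≡ t₁ ++ t₂ → t₂ ≢ [] → ¬ p ⊑ (t₂ ++ p ^w m)
    no-inner-start t₁ t₂ p′≡t₁t₂ = Primitive⇒⋢shifted-power m prim (cong (a ∷_) p′≡t₁t₂) (λ ())

  occ-power-invW : ∀ {p} → CyclicallyReduced p → p ≢ [] → ∀ m → occ (p ^w m) (invW p) ≡ 0
  occ-power-invW {p} cr p≢[] zero    = occ-[] (invW p) (invW-≢[] p≢[])
  occ-power-invW {p} cr p≢[] (suc m) =
    trans (occ-++-skip p (p ^w m) (invW p)
             λ _ _ p≡t₁t₂ → CyclicallyReduced⇒invW⋢shifted-power m cr p≡t₁t₂)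
          (occ-power-invW cr p≢[] m)

lemma6p2 : (𝔸 : InvAlphabet) → let open Words 𝔸 in
    (n : ℤ) (q : Word) → Primitive q → CyclicallyReduced q →
    δ q (powFG q n) ≡ n
lemma6p2 𝔸 (+ n) q prim cr = begin
  δ q (reduce (q ^w n))                      ≡⟨ cong (δ q) (reduce-power cr n) ⟩
  + occ (q ^w n) q - + occ (q ^w n) (invW q) ≡⟨ cong₂ (λ i j → + i - + j)
                                                  (occ-power-self prim n)
                                                  (occ-power-invW cr (proj₁ prim) n) ⟩
  + n - + 0                                  ≡⟨ +-identityʳ (+ n) ⟩
  + n                                        ∎
  where open Words 𝔸; open FreeGroupWords 𝔸; open ≡-Reasoning
lemma6p2 𝔸 -[1+ n ] q prim cr = begin
  δ q (reduce (q̄ ^w suc n))                          ≡⟨ cong (δ q) (reduce-power cr̄ (suc n)) ⟩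
  + occ (q̄ ^w suc n) q - + occ (q̄ ^w suc n) q̄        ≡⟨ cong₂ (λ i j → + i - + j) no-q
                                                          (occ-power-self prim̄ (suc n)) ⟩
  + 0 - + suc n                                      ≡⟨⟩
  -[1+ n ]                                           ∎
  where
  open Words 𝔸; open FreeGroupWords 𝔸; open ≡-Reasoning
  q̄ : Word
  q̄ = invW q
  prim̄ : Primitive q̄
  prim̄ = Primitive-invW q prim
  cr̄ : CyclicallyReduced q̄
  cr̄ = CyclicallyReduced-invW q cr
  no-q : occ (q̄ ^w suc n) q ≡ 0
  no-q = trans (cong (occ (q̄ ^w suc n)) (sym (invW-involutive q)))
               (occ-power-invW cr̄ (proj₁ prim̄) (suc n))
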